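{- Let $H=(V,\mathcal{E})$ be a $\beta$-acyclic hypergraph and let $M$ be a doubly lexically ordered incidence matrix of $H$. Let $E_i$ and $E_j$ be two hyperedges of $H$ and let $v$ be the vertex of $E_i$ which is earliest in the doubly lexical ordering (i.e., whose row is highest in $M$). Then $E_i\subseteq E_j$ if and only if $E_i\preceq E_j$ and $v\in E_j$.
   Context: A hypergraph has a finite vertex set and a family of nonempty hyperedges (distinct hyperedges may be equal as sets). A join tree for a hypergraph is a tree whose nodes are its hyperedges such that, for every vertex, the hyperedges containing it induce a connected subtree; a hypergraph is acyclic if it has one. A family of sets forms the hypergraph whose vertex set is its union and whose hyperedges are its members. $H$ is $\beta$-acyclic if every nonempty subfamily of $\mathcal{E}$ forms an acyclic hypergraph. The incidence matrix of $H$ is the binary $n\times m$ matrix with rows indexed by vertices, columns by hyperedges, and entry $1$ iff the vertex lies in the hyperedge. It is doubly lexically ordered if rows and columns are permuted so that the row vectors (top to bottom) and the column vectors (left to right) are each in non-decreasing lexicographic order, where within a row the priority of entries decreases from right to left and within a column the priority decreases from bottom to top (so of two differing columns, the larger is the one having the $1$ in the bottom-most row where they differ). For hyperedges $E_i,E_j$, $E_i\preceq E_j$ means the column of $E_i$ is lexicographically smaller than or equal to the column of $E_j$ in this sense. -}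

module Defs where

open import Data.Nat using (ℕ; suc)
open import Data.Fin using (Fin; zero; suc; inject₁; fromℕ; _<_)
open import Data.Bool using (Bool; true; false)
open import Data.Product using (Σ; _×_; ∃)
open import Data.Sum using (_⊎_)
open import Data.Unit using (⊤)
open import Data.Empty using (⊥)
open import Relation.Binary.PropositionalEquality using (_≡_)
open import Function.Definitions using (Injective)

-- A hypergraph with n vertices and m hyperedges is given by its n×m incidence
-- matrix M : Fin n → Fin m → Bool (rows = vertices, columns = hyperedges);
-- hyperedge j is { v | M v j ≡ true }.  The row/column order of M is the
-- order in which the matrix is displayed (row 0 = top, column 0 = left).

Matrix : ℕ → ℕ → Set
Matrix n m = Fin n → Fin m → Bool

column : ∀ {n m} → Matrix n m → Fin m → Fin n → Bool
column M j v = M v j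

row : ∀ {n m} → Matrix n m → Fin n → Fin m → Bool
row M v j = M v j

NonemptyEdges : ∀ {n m} → Matrix n m → Set
NonemptyEdges {n} M = ∀ j → Σ (Fin n) (λ v → M v j ≡ true)

-- Lexicographic order on 0/1 vectors where priority DEcreases towards
-- smaller indices (the largest index has highest priority):
-- f ≼ g iff f = g, or at the largest position p where they differ,
-- f p = 0 and g p = 1.  For rows: highest index = rightmost column;
-- for columns: highest index = bottom-most row.

LexLe : ∀ {k} → (Fin k → Bool) → (Fin k → Bool) → Set
LexLe {k} f g =
  (∀ q → f q ≡ g q)
  ⊎ Σ (Fin k) (λ p → f p ≡ false × g p ≡ true × (∀ q → p < q → f q ≡ g q))

DoublyLex : ∀ {n m} → Matrix n m → Set
DoublyLex M =
  (∀ u v → u < v → LexLe (row M u) (row M v))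
  × (∀ i j → i < j → LexLe (column M i) (column M j))

_⪯[_]_ : ∀ {n m} → Fin m → Matrix n m → Fin m → Set
i ⪯[ M ] j = LexLe (column M i) (column M j)

Graph : ℕ → Set
Graph k = Fin k → Fin k → Bool

data PathIn {k} (G : Graph k) (P : Fin k → Set) : Fin k → Fin k → Set where
  here : ∀ {a} → P a → PathIn G P a a
  step : ∀ {a b c} → P a → G a b ≡ true → PathIn G P b c → PathIn G P a c

record SimpleCycle {k} (G : Graph k) : Set where
  field
    l        : ℕ
    c        : Fin (suc (suc (suc l))) → Fin k
    distinct : Injective _≡_ _≡_ c
    adjacent : ∀ (i : Fin (suc (suc l))) → G (c (inject₁ i)) (c (suc i)) ≡ true
    closing  : G (c (fromℕ (suc (suc l)))) (c zero) ≡ true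

IsTree : ∀ {k} → Graph k → Set
IsTree G =
  (∀ a b → G a b ≡ G b a)
  × (∀ a → G a a ≡ false)
  × (∀ a b → PathIn G (λ _ → ⊤) a b)
  × (SimpleCycle G → ⊥)

IsJoinTree : ∀ {n k} → (Fin k → Fin n → Bool) → Graph k → Set
IsJoinTree {n} C T =
  IsTree T
  × (∀ (v : Fin n) a b → C a v ≡ true → C b v ≡ true
       → PathIn T (λ c → C c v ≡ true) a b)

Acyclic : ∀ {n k} → (Fin k → Fin n → Bool) → Set
Acyclic {k = k} C = Σ (Graph k) (IsJoinTree C)

-- β-acyclic: every nonempty subfamily (selected by an injective index map
-- s : Fin (suc k) → Fin m; members may coincide as sets) forms an acyclic hypergraph
BetaAcyclic : ∀ {n m} → Matrix n m → Set
BetaAcyclic {n} {m} M =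
  ∀ (k : ℕ) (s : Fin (suc k) → Fin m) → Injective _≡_ _≡_ s
    → Acyclic (λ a v → M v (s a))

{-# OPTIONS --safe #-}
module Submission where

-- If u ∈ E_i ∖ E_j, then v < u because v is the first vertex of E_i, and i < j because
-- E_i ⪯ E_j with different columns; so rows v, u and columns i, j carry the submatrix
-- [[1,1],[1,0]] (a Γ).  A doubly lexical β-acyclic matrix has no Γ: starting from a Γ,
-- the lexicographic order of the two rows produces a new column further right and that
-- of the two columns a new row further down, extending the Γ to a longer induced path
-- of the incidence graph.  Its last row strictly increases, so eventually the last row
-- meets the first column and the path closes into a cycle, which no join tree allows.

open import Defs
open import Data.Nat using (ℕ; zero; suc; s≤s)
import Data.Nat.Properties as ℕ
open import Data.Fin using (Fin; _<_; _≤_; _>_; zero; suc; inject₁; fromℕ; opposite)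
open import Data.Fin.Properties
  using (<-cmp; <-trans; <-irrefl; ≤∧≢⇒<; suc-injective; opposite-involutive)
open import Data.Fin.Induction using (>-wellFounded)
open import Data.Vec.Functional using (_∷_; []; reverse)
open import Data.Bool using (Bool; true; false)
open import Data.Product using (_×_; _,_; Σ; proj₁; proj₂)
open import Data.Sum using (_⊎_; inj₁; inj₂; swap)
open import Data.Empty using (⊥; ⊥-elim)
open import Induction.WellFounded using (Acc; acc)
open import Relation.Binary using (tri<; tri≈; tri>)
open import Relation.Nullary using (¬_)
open import Relation.Binary.PropositionalEquality
  using (_≡_; refl; sym; trans; cong; subst; _≢_)
open import Function.Base using (_∘_)
open import Function.Bundles using (_⇔_; mk⇔)
open import Function.Definitions using (Injective)

bool-clash : ∀ {A : Set} {b : Bool} → b ≡ true → b ≡ false → A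
bool-clash refl ()

opposite-inject₁ : ∀ {k} (i : Fin k) → opposite {suc k} (inject₁ i) ≡ suc (opposite i)
opposite-inject₁ {suc k} zero    = refl
opposite-inject₁ {suc k} (suc i) = cong inject₁ (opposite-inject₁ i)

opposite-fromℕ : ∀ k → opposite (fromℕ k) ≡ zero
opposite-fromℕ zero    = refl
opposite-fromℕ (suc k) = cong inject₁ (opposite-fromℕ k)

opposite-injective : ∀ {k} → Injective _≡_ _≡_ (opposite {k})
opposite-injective {x = a} {b} eq =
  trans (sym (opposite-involutive a)) (trans (cong opposite eq) (opposite-involutive b))

inject₁≢suc : ∀ {k} (i : Fin k) → inject₁ i ≢ suc i
inject₁≢suc zero    ()
inject₁≢suc (suc i) eq = inject₁≢suc i (suc-injective eq)

DecisiveAt : ∀ {k} → (Fin k → Bool) → (Fin k → Bool) → Fin k → Set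
DecisiveAt f g p = f p ≡ false × g p ≡ true × (∀ q → p < q → f q ≡ g q)

⊆⇒LexLe : ∀ {k} {f g : Fin k → Bool} → (∀ q → f q ≡ true → g q ≡ true) → LexLe f g
⊆⇒LexLe {zero}  f⊆g = inj₁ λ ()
⊆⇒LexLe {suc k} {f} {g} f⊆g with ⊆⇒LexLe {f = λ q → f (suc q)} {g = λ q → g (suc q)} (λ q → f⊆g (suc q))
... | inj₂ (p , fp , gp , above-p) =
  inj₂ (suc p , fp , gp , λ { zero () ; (suc q) (s≤s p<q) → above-p q p<q })
... | inj₁ tail-eq with f zero in f₀ | g zero in g₀
...   | false | false = inj₁ λ { zero → trans f₀ (sym g₀) ; (suc q) → tail-eq q }
...   | true  | true  = inj₁ λ { zero → trans f₀ (sym g₀) ; (suc q) → tail-eq q }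
...   | false | true  = inj₂ (zero , f₀ , g₀ , λ { zero () ; (suc q) _ → tail-eq q })
...   | true  | false = bool-clash (f⊆g zero f₀) g₀

LexLe-antisym : ∀ {k} {f g : Fin k → Bool} → LexLe f g → LexLe g f → ∀ q → f q ≡ g q
LexLe-antisym (inj₁ f≗g) _ = f≗g
LexLe-antisym (inj₂ _) (inj₁ g≗f) q = sym (g≗f q)
LexLe-antisym (inj₂ (p , fp , gp , above-p)) (inj₂ (p′ , gp′ , fp′ , above-p′)) q
  with <-cmp p p′
... | tri< p<p′ _ _ = bool-clash (trans (sym (above-p p′ p<p′)) fp′) gp′
... | tri≈ _ refl _ = bool-clash fp′ fp
... | tri> _ _ p′<p = bool-clash (trans (sym (above-p′ p p′<p)) gp) fp

LexLe-rise-above : ∀ {k} {f g : Fin k → Bool} {c} → LexLe f g → f c ≡ true → g c ≡ false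
                 → Σ (Fin k) λ p → c < p × DecisiveAt f g p
LexLe-rise-above {c = c} (inj₁ f≗g) fc gc = bool-clash (trans (sym (f≗g c)) fc) gc
LexLe-rise-above {c = c} (inj₂ (p , fp , gp , above-p)) fc gc with <-cmp c p
... | tri< c<p _ _ = p , c<p , fp , gp , above-p
... | tri≈ _ refl _ = bool-clash fc fp
... | tri> _ _ p<c = bool-clash (trans (sym (above-p c p<c)) fc) gc

⪯-separated⇒< : ∀ {n m} {M : Matrix n m} {i j : Fin m} {u : Fin n} → DoublyLex M
              → i ⪯[ M ] j → M u i ≡ true → M u j ≡ false → i < j
⪯-separated⇒< {i = i} {j} {u} (_ , cols-lex) i⪯j u∈i u∉j =
  ≤∧≢⇒< (ℕ.≮⇒≥ j≮i) λ { refl → bool-clash u∈i u∉j }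
  where
  j≮i : ¬ j < i
  j≮i j<i = bool-clash (trans (sym (LexLe-antisym i⪯j (cols-lex j i j<i) u)) u∈i) u∉j

PathIn-source : ∀ {k} {G : Graph k} {P : Fin k → Set} {a b} → PathIn G P a b → P a
PathIn-source (here Pa)     = Pa
PathIn-source (step Pa _ _) = Pa

path-within-pair⇒edge : ∀ {k} {G : Graph k} {P : Fin k → Set} → (∀ a → G a a ≡ false)
                      → ∀ {a b} → a ≢ b → (∀ c → P c → c ≡ a ⊎ c ≡ b)
                      → PathIn G P a b → G a b ≡ true
path-within-pair⇒edge loopless a≢b within (here _) = ⊥-elim (a≢b refl)
path-within-pair⇒edge loopless {a} a≢b within (step _ Gad rest)
  with within _ (PathIn-source rest)
... | inj₁ refl = bool-clash Gad (loopless a)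
... | inj₂ refl = Gad

module Γ-Freeness {n m} (M : Matrix n m) (β-acyclic : BetaAcyclic M) (doubly-lex : DoublyLex M)
  where

  -- x 0, y 0, x 1, …, y L, x (L+1), r is an induced path in the incidence graph
  -- (columns x, rows y and r); it closes into a cycle as soon as r ∋ x 0.
  record Chain (L : ℕ) : Set where
    field
      x : Fin (suc (suc L)) → Fin m
      y : Fin (suc L) → Fin n
      r : Fin n
      y∋left      : ∀ i → M (y i) (x (inject₁ i)) ≡ true
      y∋right     : ∀ i → M (y i) (x (suc i)) ≡ true
      y-only      : ∀ i j → M (y i) (x j) ≡ true → j ≡ inject₁ i ⊎ j ≡ suc i
      r∋last      : M r (x (fromℕ (suc L))) ≡ true
      r-only      : ∀ j → M r (x j) ≡ true → j ≡ zero ⊎ j ≡ fromℕ (suc L)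
      y₀<r        : y zero < r
      last<x₀     : x (fromℕ (suc L)) < x zero
      x≤x₀        : ∀ j → x j ≤ x zero
      x-injective : Injective _≡_ _≡_ x
      rows-agree-right-of-x₀ : ∀ i c → x zero < c → M (y i) c ≡ M (y zero) c
      cols-agree-below-r     : ∀ j z → r < z → M z (x (suc j)) ≡ M z (x (fromℕ (suc L)))

  module Extend {L} (S : Chain L) where
    open Chain S

    -- p is where row r overtakes row y 0, q is where column x 0 overtakes column x (L+1);
    -- the new path p, r, x (L+1), y L, …, y 0, x 0, q runs in the opposite direction.
    module _ {p} (x₀<p : x zero < p) (y₀∌p : M (y zero) p ≡ false) (r∋p : M r p ≡ true)
      (rows-agree-right-of-p : ∀ c → p < c → M (y zero) c ≡ M r c)
      {q} (r<q : r < q) (q∌last : M q (x (fromℕ (suc L))) ≡ false) (q∋x₀ : M q (x zero) ≡ true)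
      (cols-agree-below-q : ∀ z → q < z → M z (x (fromℕ (suc L))) ≡ M z (x zero))
      (r∌x₀ : M r (x zero) ≡ false)
      where

      x′ : Fin (suc (suc (suc L))) → Fin m
      x′ = p ∷ reverse x

      y′ : Fin (suc (suc L)) → Fin n
      y′ = r ∷ reverse y

      x′-last : x′ (fromℕ (suc (suc L))) ≡ x zero
      x′-last = cong x (opposite-fromℕ (suc L))

      y′∋left : ∀ i → M (y′ i) (x′ (inject₁ i)) ≡ true
      y′∋left zero    = r∋p
      y′∋left (suc i) = subst (λ k → M (y (opposite i)) (x k) ≡ true) (sym (opposite-inject₁ i))
                              (y∋right (opposite i))

      y′∋right : ∀ i → M (y′ i) (x′ (suc i)) ≡ true
      y′∋right zero    = r∋last
      y′∋right (suc i) = y∋left (opposite i)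

      y∌p : ∀ i → M (y i) p ≡ false
      y∌p i = trans (rows-agree-right-of-x₀ i p x₀<p) y₀∌p

      y′-only : ∀ i j → M (y′ i) (x′ j) ≡ true → j ≡ inject₁ i ⊎ j ≡ suc i
      y′-only zero    zero    _   = inj₁ refl
      y′-only zero    (suc j) r∋  with r-only (opposite j) r∋
      ... | inj₁ e = bool-clash (subst (λ k → M r (x k) ≡ true) e r∋) r∌x₀
      ... | inj₂ e = inj₂ (cong suc (opposite-injective e))
      y′-only (suc i) zero    y∋p = bool-clash y∋p (y∌p (opposite i))
      y′-only (suc i) (suc j) y∋  with y-only (opposite i) (opposite j) y∋
      ... | inj₁ e = inj₂ (cong suc (opposite-injective e))
      ... | inj₂ e = inj₁ (cong suc (opposite-injective (trans e (sym (opposite-inject₁ i)))))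

      q∋x′-last : M q (x′ (fromℕ (suc (suc L)))) ≡ true
      q∋x′-last = subst (λ c → M q c ≡ true) (sym x′-last) q∋x₀

      q-only : ∀ j → M q (x′ j) ≡ true → j ≡ zero ⊎ j ≡ fromℕ (suc (suc L))
      q-only zero    _  = inj₁ refl
      q-only (suc j) q∋ with opposite j in e
      ... | zero  = inj₂ (cong suc (trans (sym (opposite-involutive j)) (cong opposite e)))
      ... | suc k = bool-clash (trans (sym (cols-agree-below-r k q r<q)) q∋) q∌last

      x<p : ∀ j → x j < p
      x<p j = ℕ.≤-<-trans (x≤x₀ j) x₀<p

      x′≤p : ∀ j → x′ j ≤ p
      x′≤p zero    = ℕ.≤-refl
      x′≤p (suc j) = ℕ.<⇒≤ (x<p (opposite j))

      x′-injective : Injective _≡_ _≡_ x′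
      x′-injective {zero}  {zero}  _ = refl
      x′-injective {zero}  {suc b} e = ⊥-elim (<-irrefl (sym e) (x<p (opposite b)))
      x′-injective {suc a} {zero}  e = ⊥-elim (<-irrefl e (x<p (opposite a)))
      x′-injective {suc a} {suc b} e = cong suc (opposite-injective (x-injective e))

      rows-agree-right-of-p′ : ∀ i c → p < c → M (y′ i) c ≡ M r c
      rows-agree-right-of-p′ zero    _ _   = refl
      rows-agree-right-of-p′ (suc i) c p<c =
        trans (rows-agree-right-of-x₀ (opposite i) c (<-trans x₀<p p<c)) (rows-agree-right-of-p c p<c)

      cols-agree-below-q′ : ∀ j z → q < z → M z (x′ (suc j)) ≡ M z (x′ (fromℕ (suc (suc L))))
      cols-agree-below-q′ j z q<z with opposite j
      ... | zero  = cong (M z) (sym x′-last)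
      ... | suc k = trans (cols-agree-below-r k z (<-trans r<q q<z))
                          (trans (cols-agree-below-q z q<z) (cong (M z) (sym x′-last)))

      extended : Chain (suc L)
      extended = record
        { x = x′ ; y = y′ ; r = q
        ; y∋left = y′∋left ; y∋right = y′∋right ; y-only = y′-only
        ; r∋last = q∋x′-last ; r-only = q-only
        ; y₀<r = r<q
        ; last<x₀ = subst (_< p) (sym x′-last) x₀<p
        ; x≤x₀ = x′≤p ; x-injective = x′-injective
        ; rows-agree-right-of-x₀ = rows-agree-right-of-p′
        ; cols-agree-below-r = cols-agree-below-q′
        }

  open Chain

  closed-chain⇒⊥ : ∀ {L} (S : Chain (suc L)) → M (r S) (x S zero) ≡ true → ⊥
  closed-chain⇒⊥ {L} S r∋x₀ with β-acyclic (suc (suc L)) (x S) (x-injective S)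
  ... | T , (_ , loopless , _ , acyclic) , subtrees = acyclic record
    { l        = L
    ; c        = λ a → a
    ; distinct = λ eq → eq
    ; adjacent = λ i → path-within-pair⇒edge loopless (inject₁≢suc i) (y-only S i)
                         (subtrees (y S i) _ _ (y∋left S i) (y∋right S i))
    ; closing  = path-within-pair⇒edge loopless (λ ()) (λ c → swap ∘ r-only S c)
                   (subtrees (r S) _ _ (r∋last S) r∋x₀)
    }

  extend : ∀ {L} (S : Chain L) → M (r S) (x S zero) ≡ false
         → Σ (Chain (suc L)) λ S′ → r S < r S′
  extend S r∌x₀
    with LexLe-rise-above (proj₁ doubly-lex _ _ (y₀<r S)) (y∋left S zero) r∌x₀
       | LexLe-rise-above (proj₂ doubly-lex _ _ (last<x₀ S)) (r∋last S) r∌x₀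
  ... | p , x₀<p , y₀∌p , r∋p , right-of-p | q , r<q , q∌last , q∋x₀ , below-q =
    Extend.extended S x₀<p y₀∌p r∋p right-of-p r<q q∌last q∋x₀ below-q r∌x₀ , r<q

  no-long-chain : ∀ {L} (S : Chain (suc L)) → Acc _>_ (r S) → ⊥
  no-long-chain S (acc larger) with M (r S) (x S zero) in r-at-x₀
  ... | true  = closed-chain⇒⊥ S r-at-x₀
  ... | false with extend S r-at-x₀
  ...   | S′ , r<r′ = no-long-chain S′ (larger r<r′)

  Γ-free : ∀ {r₁ r₂ : Fin n} {c₁ c₂ : Fin m} → r₁ < r₂ → c₁ < c₂
         → M r₁ c₁ ≡ true → M r₁ c₂ ≡ true → M r₂ c₁ ≡ true → M r₂ c₂ ≡ false → ⊥
  Γ-free {r₁} {r₂} {c₁} {c₂} r₁<r₂ c₁<c₂ r₁∋c₁ r₁∋c₂ r₂∋c₁ r₂∌c₂ =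
    no-long-chain (proj₁ (extend Γ r₂∌c₂)) (>-wellFounded _)
    where
    Γ : Chain 0
    Γ = record
      { x = c₂ ∷ c₁ ∷ [] ; y = λ _ → r₁ ; r = r₂
      ; y∋left  = λ { zero → r₁∋c₂ }
      ; y∋right = λ { zero → r₁∋c₁ }
      ; y-only  = λ { zero zero _ → inj₁ refl ; zero (suc zero) _ → inj₂ refl }
      ; r∋last  = r₂∋c₁
      ; r-only  = λ { zero _ → inj₁ refl ; (suc zero) _ → inj₂ refl }
      ; y₀<r    = r₁<r₂
      ; last<x₀ = c₁<c₂
      ; x≤x₀    = λ { zero → ℕ.≤-refl ; (suc zero) → ℕ.<⇒≤ c₁<c₂ }
      ; x-injective = λ { {zero} {zero} _ → refl ; {suc zero} {suc zero} _ → refl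
                        ; {zero} {suc zero} e → ⊥-elim (<-irrefl (sym e) c₁<c₂)
                        ; {suc zero} {zero} e → ⊥-elim (<-irrefl e c₁<c₂) }
      ; rows-agree-right-of-x₀ = λ { zero _ _ → refl }
      ; cols-agree-below-r     = λ { zero _ _ → refl }
      }

lemma8 : ∀ {n m : ℕ} (M : Matrix n m) → NonemptyEdges M → BetaAcyclic M → DoublyLex M
    → ∀ (i j : Fin m) (v : Fin n) → M v i ≡ true → (∀ u → u < v → M u i ≡ false)
    → (∀ u → M u i ≡ true → M u j ≡ true) ⇔ (i ⪯[ M ] j × M v j ≡ true)
lemma8 M _ β-acyclic doubly-lex i j v v∈i v-first = mk⇔ forward backward
  where
  open Γ-Freeness M β-acyclic doubly-lex using (Γ-free)

  forward : (∀ u → M u i ≡ true → M u j ≡ true) → i ⪯[ M ] j × M v j ≡ true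
  forward i⊆j = ⊆⇒LexLe i⊆j , i⊆j v v∈i

  backward : i ⪯[ M ] j × M v j ≡ true → ∀ u → M u i ≡ true → M u j ≡ true
  backward (i⪯j , v∈j) u u∈i with M u j in u∉j
  ... | true  = refl
  ... | false = ⊥-elim (Γ-free v<u (⪯-separated⇒< doubly-lex i⪯j u∈i u∉j) v∈i v∈j u∈i u∉j)
    where
    v<u : v < u
    v<u = ≤∧≢⇒< (ℕ.≮⇒≥ λ u<v → bool-clash u∈i (v-first u u<v)) λ { refl → bool-clash v∈j u∉j }
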